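{- The function $-\mathrm{dom}(G)$ is robustly lift-monotone. Explicitly, for every $d$-regular graph $H$, every lift $L$ of $H$, and every $d$-regular $L'$ on $V(L)$ with $\Delta(L,L')\le\epsilon$, we have $-\mathrm{dom}(L')\ge-\mathrm{dom}(H)-\delta_H(\epsilon)$ for some $\delta_H$ with $\delta_H(\epsilon)\to0$ as $\epsilon\to0$.
   Context: $\mathrm{dom}(G)$ is the minimum size of a dominating set of $G$ divided by $|V(G)|$. A dominating set is a set $S$ such that every vertex not in $S$ has a neighbor in $S$. Lifts: for a $d$-regular $H$ on $k$ vertices with adjacency matrix $M$, a graph $G$ on $km$ vertices is a lift of $H$ if there is a balanced partition $\sigma:V(G)\to[k]$ such that each fiber $\sigma^{ -1}(i)$ induces an $M_{ii}$-regular graph, and for $i\ne j$ the edges between fibers $i$ and $j$ form an $M_{ij}$-regular bipartite graph. Distance: $\Delta(G,G')=|E(G)\triangle E(G')|/(2n)$.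
   Formalization: The parameter ε ranges over the rationals, and the function $\delta_H$ takes rational arguments and values. -}

module Defs where

open import Data.Nat using (ℕ; zero; suc; _+_; _*_; _≡ᵇ_; _<ᵇ_)
import Data.Nat
open import Data.Bool using (Bool; true; false; not; _∧_; _∨_; if_then_else_)
open import Data.Fin using (Fin; toℕ; _≟_)
import Data.Fin
open import Data.Integer using (+_)
open import Data.Rational using (ℚ; 0ℚ; _/_; _≤_; _<_; ∣_∣)
open import Data.Product using (Σ; _×_; ∃)
open import Relation.Binary.PropositionalEquality using (_≡_)
open import Relation.Nullary.Decidable using (⌊_⌋)

count : (n : ℕ) → (Fin n → Bool) → ℕ
count zero    p = 0
count (suc n) p = (if p Data.Fin.zero then 1 else 0) + count n (λ i → p (Data.Fin.suc i))

sumF : (n : ℕ) → (Fin n → ℕ) → ℕ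
sumF zero    f = 0
sumF (suc n) f = f Data.Fin.zero + sumF n (λ i → f (Data.Fin.suc i))

-- a / b as a rational; we set a / 0 = 0 (never used with b = 0 below).
ratio : ℕ → ℕ → ℚ
ratio a zero    = 0ℚ
ratio a (suc b) = (+ a) / suc b

record Graph (n : ℕ) : Set where
  field
    adj   : Fin n → Fin n → Bool
    sym   : ∀ u v → adj u v ≡ adj v u
    irrefl : ∀ v → adj v v ≡ false
open Graph public

degree : ∀ {n} → Graph n → Fin n → ℕ
degree {n} G v = count n (adj G v)

IsRegular : ∀ {n} → ℕ → Graph n → Set
IsRegular d G = ∀ v → degree G v ≡ d

-- The base graph H: a (multi)graph on Fin k given by its symmetric
-- adjacency matrix M (M i i = number of loops at i, as in the definition of lifts).

SymMat : ∀ {k} → (Fin k → Fin k → ℕ) → Set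
SymMat M = ∀ i j → M i j ≡ M j i

rowSum : ∀ {k} → (Fin k → Fin k → ℕ) → Fin k → ℕ
rowSum {k} M i = sumF k (M i)

RegularMat : ∀ {k} → ℕ → (Fin k → Fin k → ℕ) → Set
RegularMat d M = ∀ i → rowSum M i ≡ d

-- Neighbourhood relation of H: distinct i, j with M i j ≠ 0 (loops play no role in domination).
matAdj : ∀ {k} → (Fin k → Fin k → ℕ) → Fin k → Fin k → Bool
matAdj M i j = not ⌊ i ≟ j ⌋ ∧ not (M i j ≡ᵇ 0)

IsDominating : ∀ {n} → (Fin n → Fin n → Bool) → (Fin n → Bool) → Set
IsDominating A S = ∀ v → S v ≡ false → Σ _ λ u → (S u ≡ true) × (A v u ≡ true)

IsMinDomSize : ∀ {n} → (Fin n → Fin n → Bool) → ℕ → Set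
IsMinDomSize {n} A s =
  (Σ (Fin n → Bool) λ S → IsDominating A S × count n S ≡ s) ×
  (∀ S → IsDominating A S → s Data.Nat.≤ count n S)

-- G on n vertices is a lift of H (matrix M on Fin k) with fibre size m via σ:
-- every fibre has exactly m vertices, and every vertex v has exactly
-- M (σ v) j neighbours in fibre j (for j = σ v this says fibre σ v induces an
-- M_ii-regular graph; for j ≠ σ v, with symmetry of M, it says the edges between
-- fibres form an M_ij-regular bipartite graph).
IsLiftVia : ∀ {k n} → (Fin k → Fin k → ℕ) → ℕ → Graph n → (Fin n → Fin k) → Set
IsLiftVia {k} {n} M m G σ =
  (∀ i → count n (λ v → ⌊ σ v ≟ i ⌋) ≡ m) ×
  (∀ v j → count n (λ u → ⌊ σ u ≟ j ⌋ ∧ adj G v u) ≡ M (σ v) j)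

IsLift : ∀ {k n} → (Fin k → Fin k → ℕ) → ℕ → Graph n → Set
IsLift {k} {n} M m G = Σ (Fin n → Fin k) λ σ → IsLiftVia M m G σ

differ : Bool → Bool → Bool
differ true  b = not b
differ false b = b

symDiffSize : ∀ {n} → Graph n → Graph n → ℕ
symDiffSize {n} G G' =
  sumF n (λ u → count n (λ v → (toℕ u <ᵇ toℕ v) ∧ differ (adj G u v) (adj G' u v)))

dist : ∀ {n} → Graph n → Graph n → ℚ
dist {n} G G' = ratio (symDiffSize G G') (2 * n)

TendsToZeroAtZero : (ℚ → ℚ) → Set
TendsToZeroAtZero δ =
  ∀ η → 0ℚ < η → Σ ℚ λ ε₀ → (0ℚ < ε₀) × (∀ ε → 0ℚ < ε → ε ≤ ε₀ → ∣ δ ε ∣ ≤ η)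

{-# OPTIONS --safe #-}
module Submission where

-- The fibres over a minimum dominating set S of H form a dominating set of the lift L of size m·|S|.
-- Adding every vertex incident to an edge of L △ L' gives a dominating set of L', since the L-edges
-- at the remaining vertices survive in L'; by the handshake lemma there are at most 2·|E(L) △ E(L')|
-- such vertices. Dividing by km gives dom(L') ≤ dom(H) + 4·Δ(L, L'), so δ(ε) = 4ε works.

module Counting where

  open import Defs using (count; sumF)
  open import Data.Nat.Properties using (+-*-semiring; +-mono-≤; ≤-refl; +-identityʳ; *-identityˡ)
  open import Algebra.Properties.Semiring.Sum +-*-semiring
    using (sum; sum-cong-≗; sum-replicate-zero; ∑-distrib-+; ∑-comm; *-distribˡ-sum; *-distribʳ-sum)
  open import Data.Bool using (Bool; true; false; _∧_; _∨_; if_then_else_)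
  open import Data.Empty using (⊥-elim)
  open import Data.Fin using (Fin; zero; suc; _≟_)
  open import Data.Nat using (ℕ; zero; suc; _+_; _*_; _≤_; z≤n; s≤s)
  open import Data.Product using (∃; _,_)
  open import Function using (_∘_)
  open import Relation.Binary.PropositionalEquality
  open import Relation.Nullary using (yes; no)
  open import Relation.Nullary.Decidable using (⌊_⌋)

  indicator : Bool → ℕ
  indicator b = if b then 1 else 0

  sumF≡sum : ∀ n (f : Fin n → ℕ) → sumF n f ≡ sum f
  sumF≡sum zero    f = refl
  sumF≡sum (suc n) f = cong (f zero +_) (sumF≡sum n (f ∘ suc))

  count≡sum : ∀ n (p : Fin n → Bool) → count n p ≡ sum (indicator ∘ p)
  count≡sum zero    p = refl
  count≡sum (suc n) p = cong (indicator (p zero) +_) (count≡sum n (p ∘ suc))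

  sumF-count≡sum-sum : ∀ n m (p : Fin n → Fin m → Bool) →
    sumF n (λ v → count m (p v)) ≡ sum (λ v → sum (λ u → indicator (p v u)))
  sumF-count≡sum-sum n m p = trans (sumF≡sum n _) (sum-cong-≗ (λ v → count≡sum m (p v)))

  sum-mono-≤ : ∀ {n} {f g : Fin n → ℕ} → (∀ i → f i ≤ g i) → sum f ≤ sum g
  sum-mono-≤ {zero}  f≤g = z≤n
  sum-mono-≤ {suc n} f≤g = +-mono-≤ (f≤g zero) (sum-mono-≤ (f≤g ∘ suc))

  indicator-∧ : ∀ a b → indicator (a ∧ b) ≡ indicator a * indicator b
  indicator-∧ true  b = sym (*-identityˡ (indicator b))
  indicator-∧ false b = refl

  indicator-∨ : ∀ a b → indicator (a ∨ b) ≤ indicator a + indicator b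
  indicator-∨ true  b = s≤s z≤n
  indicator-∨ false b = ≤-refl

  count-∨ : ∀ n (p q : Fin n → Bool) → count n (λ i → p i ∨ q i) ≤ count n p + count n q
  count-∨ n p q = begin
    count n (λ i → p i ∨ q i)                      ≡⟨ count≡sum n _ ⟩
    sum (λ i → indicator (p i ∨ q i))              ≤⟨ sum-mono-≤ (λ i → indicator-∨ (p i) (q i)) ⟩
    sum (λ i → indicator (p i) + indicator (q i))  ≡⟨ ∑-distrib-+ (indicator ∘ p) (indicator ∘ q) ⟩
    sum (indicator ∘ p) + sum (indicator ∘ q)      ≡⟨ cong₂ _+_ (count≡sum n p) (count≡sum n q) ⟨
    count n p + count n q                          ∎
    where open Data.Nat.Properties.≤-Reasoning

  count≢0⇒∃ : ∀ n (p : Fin n → Bool) → count n p ≢ 0 → ∃ λ i → p i ≡ true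
  count≢0⇒∃ zero    p count≢0 = ⊥-elim (count≢0 refl)
  count≢0⇒∃ (suc n) p count≢0 with p zero in p0
  ... | true  = zero , p0
  ... | false with i , pi ← count≢0⇒∃ n (p ∘ suc) count≢0 = suc i , pi

  anyF : ∀ n → (Fin n → Bool) → Bool
  anyF zero    p = false
  anyF (suc n) p = p zero ∨ anyF n (p ∘ suc)

  anyF≡false⇒ : ∀ n (p : Fin n → Bool) → anyF n p ≡ false → ∀ i → p i ≡ false
  anyF≡false⇒ (suc n) p none zero    with p zero
  ... | false = refl
  anyF≡false⇒ (suc n) p none (suc i) with p zero
  ... | false = anyF≡false⇒ n (p ∘ suc) none i

  indicator-anyF≤count : ∀ n (p : Fin n → Bool) → indicator (anyF n p) ≤ count n p
  indicator-anyF≤count zero    p = z≤n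
  indicator-anyF≤count (suc n) p with p zero
  ... | true  = s≤s z≤n
  ... | false = indicator-anyF≤count n (p ∘ suc)

  ⌊suc≟suc⌋ : ∀ {k} (a i : Fin k) → ⌊ suc a ≟ suc i ⌋ ≡ ⌊ a ≟ i ⌋
  ⌊suc≟suc⌋ a i with a ≟ i
  ... | yes _ = refl
  ... | no  _ = refl

  sum-δ : ∀ {k} (a : Fin k) (q : Fin k → Bool) →
    sum (λ i → indicator (⌊ a ≟ i ⌋ ∧ q i)) ≡ indicator (q a)
  sum-δ {suc k} zero    q = trans (cong (indicator (q zero) +_) (sum-replicate-zero k)) (+-identityʳ _)
  sum-δ {suc k} (suc a) q =
    trans (sum-cong-≗ (λ i → cong (λ b → indicator (b ∧ q (suc i))) (⌊suc≟suc⌋ a i))) (sum-δ a (q ∘ suc))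

  count-preimage : ∀ {k n} (σ : Fin n → Fin k) m → (∀ i → count n (λ v → ⌊ σ v ≟ i ⌋) ≡ m) →
    (S : Fin k → Bool) → count n (S ∘ σ) ≡ m * count k S
  count-preimage {k} {n} σ m fibre S = begin
    count n (S ∘ σ)
      ≡⟨ count≡sum n _ ⟩
    sum (λ v → indicator (S (σ v)))
      ≡⟨ sum-cong-≗ (λ v → sum-δ (σ v) S) ⟨
    sum (λ v → sum (λ i → indicator (⌊ σ v ≟ i ⌋ ∧ S i)))
      ≡⟨ ∑-comm (λ v i → indicator (⌊ σ v ≟ i ⌋ ∧ S i)) ⟩
    sum (λ i → sum (λ v → indicator (⌊ σ v ≟ i ⌋ ∧ S i)))
      ≡⟨ sum-cong-≗ fibre-sum ⟩
    sum (λ i → m * indicator (S i))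
      ≡⟨ *-distribˡ-sum m (indicator ∘ S) ⟨
    m * sum (indicator ∘ S)
      ≡⟨ cong (m *_) (count≡sum k S) ⟨
    m * count k S
      ∎
    where
      open ≡-Reasoning
      fibre-sum : ∀ i → sum (λ v → indicator (⌊ σ v ≟ i ⌋ ∧ S i)) ≡ m * indicator (S i)
      fibre-sum i = begin
        sum (λ v → indicator (⌊ σ v ≟ i ⌋ ∧ S i))
          ≡⟨ sum-cong-≗ (λ v → indicator-∧ ⌊ σ v ≟ i ⌋ (S i)) ⟩
        sum (λ v → indicator ⌊ σ v ≟ i ⌋ * indicator (S i))
          ≡⟨ *-distribʳ-sum (indicator (S i)) (λ v → indicator ⌊ σ v ≟ i ⌋) ⟨
        sum (λ v → indicator ⌊ σ v ≟ i ⌋) * indicator (S i)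
          ≡⟨ cong (_* indicator (S i)) (trans (sym (count≡sum n _)) (fibre i)) ⟩
        m * indicator (S i)
          ∎

module Graphs where

  open import Defs using (Graph; adj; irrefl; count; sumF; degree; differ)
  open Counting
  open import Data.Bool using (Bool; true; false; _∧_; T)
  open import Data.Fin using (Fin; toℕ)
  open import Data.Fin.Properties using (toℕ-injective)
  open import Data.Nat using (ℕ; _+_; _*_; _≤_; _<_; _<ᵇ_)
  open import Data.Nat.Properties
    using (+-*-semiring; <ᵇ⇒<; <⇒<ᵇ; ≮⇒≥; <-asym; ≤-antisym; +-identityʳ)
  open import Algebra.Properties.Semiring.Sum +-*-semiring using (sum; sum-cong-≗; ∑-distrib-+; ∑-comm)
  open import Relation.Binary.PropositionalEquality
  open import Function using (_∘_)
  open import Relation.Nullary using (contradiction)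

  symDiff : ∀ {n} → Graph n → Graph n → Graph n
  symDiff G G' = record
    { adj    = λ u v → differ (adj G u v) (adj G' u v)
    ; sym    = λ u v → cong₂ differ (Graph.sym G u v) (Graph.sym G' u v)
    ; irrefl = λ v → cong₂ differ (irrefl G v) (irrefl G' v)
    }

  edgeCount : ∀ {n} → Graph n → ℕ
  edgeCount {n} G = sumF n (λ u → count n (λ v → (toℕ u <ᵇ toℕ v) ∧ adj G u v))

  nonIsolated : ∀ {n} → Graph n → Fin n → Bool
  nonIsolated {n} G v = anyF n (adj G v)

  <ᵇ≡true⇒< : ∀ {m n} → (m <ᵇ n) ≡ true → m < n
  <ᵇ≡true⇒< {m} {n} m<ᵇn = <ᵇ⇒< m n (subst T (sym m<ᵇn) _)

  <ᵇ≡false⇒≥ : ∀ {m n} → (m <ᵇ n) ≡ false → n ≤ m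
  <ᵇ≡false⇒≥ m≮ᵇn = ≮⇒≥ (λ m<n → subst T m≮ᵇn (<⇒<ᵇ m<n))

  indicator-adj-split : ∀ {n} (G : Graph n) (v u : Fin n) →
    indicator (adj G v u) ≡
    indicator ((toℕ v <ᵇ toℕ u) ∧ adj G v u) + indicator ((toℕ u <ᵇ toℕ v) ∧ adj G u v)
  indicator-adj-split G v u with toℕ v <ᵇ toℕ u in v<u | toℕ u <ᵇ toℕ v in u<v
  ... | true  | true  = contradiction (<ᵇ≡true⇒< {toℕ u} u<v) (<-asym (<ᵇ≡true⇒< {toℕ v} v<u))
  ... | true  | false = sym (+-identityʳ _)
  ... | false | true  = cong indicator (Graph.sym G v u)
  ... | false | false = cong indicator (subst (λ w → adj G v w ≡ false) v≡u (irrefl G v))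
    where
      v≡u : v ≡ u
      v≡u = toℕ-injective (≤-antisym (<ᵇ≡false⇒≥ {toℕ u} u<v) (<ᵇ≡false⇒≥ {toℕ v} v<u))

  handshake : ∀ {n} (G : Graph n) → sumF n (degree G) ≡ 2 * edgeCount G
  handshake {n} G = begin
    sumF n (degree G)                              ≡⟨ sumF-count≡sum-sum n n (adj G) ⟩
    sum (λ v → sum (λ u → indicator (adj G v u)))  ≡⟨ sum-cong-≗ (sum-cong-≗ ∘ indicator-adj-split G) ⟩
    sum (λ v → sum (λ u → X v u + X u v))          ≡⟨ sum-cong-≗ (λ v → ∑-distrib-+ (X v) (λ u → X u v)) ⟩
    sum (λ v → sum (X v) + sum (λ u → X u v))      ≡⟨ ∑-distrib-+ (λ v → sum (X v)) _ ⟩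
    E + sum (λ v → sum (λ u → X u v))              ≡⟨ cong (E +_) (∑-comm (λ v u → X u v)) ⟩
    E + E                                          ≡⟨ cong (E +_) (+-identityʳ E) ⟨
    2 * E                                          ≡⟨ cong (2 *_) (sumF-count≡sum-sum n n _) ⟨
    2 * edgeCount G                                ∎
    where
      open ≡-Reasoning
      X : Fin n → Fin n → ℕ
      X v u = indicator ((toℕ v <ᵇ toℕ u) ∧ adj G v u)
      E : ℕ
      E = sum (λ v → sum (X v))

  count-nonIsolated≤2*edgeCount : ∀ {n} (G : Graph n) → count n (nonIsolated G) ≤ 2 * edgeCount G
  count-nonIsolated≤2*edgeCount {n} G = begin
    count n (nonIsolated G)                ≡⟨ count≡sum n _ ⟩
    sum (λ v → indicator (nonIsolated G v)) ≤⟨ sum-mono-≤ (λ v → indicator-anyF≤count n (adj G v)) ⟩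
    sum (degree G)                         ≡⟨ sumF≡sum n (degree G) ⟨
    sumF n (degree G)                      ≡⟨ handshake G ⟩
    2 * edgeCount G                        ∎
    where open Data.Nat.Properties.≤-Reasoning

module Lifts where

  open import Defs using (Graph; adj; count; differ; matAdj; IsDominating; IsLiftVia; IsMinDomSize; symDiffSize)
  open Counting
  open Graphs
  open import Data.Bool using (Bool; true; false; not; _∧_; _∨_)
  open import Data.Bool.Properties using (T-≡; ∧-conicalˡ; ∧-conicalʳ; ∨-conicalˡ; ∨-conicalʳ)
  open import Data.Fin using (Fin; _≟_)
  open import Data.Nat using (ℕ; suc; _+_; _*_; _≤_; _≡ᵇ_)
  open import Data.Nat.Properties using (+-mono-≤; ≤-reflexive)
  open import Data.Product using (∃; _×_; _,_)
  open import Function using (_∘_; Equivalence)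
  open import Relation.Binary.PropositionalEquality
  open import Relation.Nullary.Decidable using (⌊_⌋; toWitness)

  NeighbourCounts : ∀ {k n} → (Fin k → Fin k → ℕ) → Graph n → (Fin n → Fin k) → Set
  NeighbourCounts {n = n} M L σ = ∀ v j → count n (λ u → ⌊ σ u ≟ j ⌋ ∧ adj L v u) ≡ M (σ v) j

  matAdj⇒≢0 : ∀ {k} (M : Fin k → Fin k → ℕ) i j → matAdj M i j ≡ true → M i j ≢ 0
  matAdj⇒≢0 M i j ij = ≢0 (M i j) (∧-conicalʳ _ _ ij)
    where
      ≢0 : ∀ x → not (x ≡ᵇ 0) ≡ true → x ≢ 0
      ≢0 (suc x) _ ()

  lift-neighbour : ∀ {k n} (M : Fin k → Fin k → ℕ) (L : Graph n) (σ : Fin n → Fin k) →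
    NeighbourCounts M L σ → ∀ v j → matAdj M (σ v) j ≡ true →
    ∃ λ u → σ u ≡ j × adj L v u ≡ true
  lift-neighbour {n = n} M L σ counts v j σv~j
    with u , u∈j∧v~u ← count≢0⇒∃ n _ (matAdj⇒≢0 M (σ v) j σv~j ∘ trans (sym (counts v j)))
    = u , toWitness {a? = σ u ≟ j} (Equivalence.from T-≡ (∧-conicalˡ _ _ u∈j∧v~u))
        , ∧-conicalʳ _ _ u∈j∧v~u

  differ≡false⇒ : ∀ {a b} → differ a b ≡ false → a ≡ true → b ≡ true
  differ≡false⇒ {true} {true} _ _ = refl

  lift-dominating : ∀ {k n} (M : Fin k → Fin k → ℕ) (L L' : Graph n) (σ : Fin n → Fin k) →
    NeighbourCounts M L σ → (S : Fin k → Bool) → IsDominating (matAdj M) S →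
    IsDominating (adj L') (λ v → S (σ v) ∨ nonIsolated (symDiff L L') v)
  lift-dominating {n = n} M L L' σ counts S S-dom v v∉
    with j , j∈S , σv~j ← S-dom (σ v) (∨-conicalˡ _ _ v∉)
    with u , σu≡j , v~u ← lift-neighbour M L σ counts v j σv~j
    = u , u∈ , differ≡false⇒ (anyF≡false⇒ n _ (∨-conicalʳ _ _ v∉) u) v~u
    where
      u∈ : S (σ u) ∨ nonIsolated (symDiff L L') u ≡ true
      u∈ rewrite σu≡j | j∈S = refl

  minDom-lift-bound : ∀ {k n m} (M : Fin k → Fin k → ℕ) (L L' : Graph n) (σ : Fin n → Fin k) →
    IsLiftVia M m L σ → ∀ {s s'} → IsMinDomSize (matAdj M) s → IsMinDomSize (adj L') s' →
    s' ≤ m * s + 2 * symDiffSize L L'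
  minDom-lift-bound {k} {n} {m} M L L' σ (fibres , counts) ((S , S-dom , refl) , _) (_ , minimal) = begin
    _
      ≤⟨ minimal _ (lift-dominating M L L' σ counts S S-dom) ⟩
    count n (λ v → S (σ v) ∨ nonIsolated (symDiff L L') v)
      ≤⟨ count-∨ n (S ∘ σ) _ ⟩
    count n (S ∘ σ) + count n (nonIsolated (symDiff L L'))
      ≤⟨ +-mono-≤ (≤-reflexive (count-preimage σ m fibres S)) (count-nonIsolated≤2*edgeCount (symDiff L L')) ⟩
    m * count k S + 2 * symDiffSize L L'
      ∎
    where open Data.Nat.Properties.≤-Reasoning

module Fractions where

  open import Defs using (ratio; TendsToZeroAtZero)
  open import Data.Integer as ℤ using (+_; +≤+)
  open import Data.Integer.Properties using (pos-*)
  open import Data.Nat as ℕ using (ℕ; suc)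
  open import Data.Nat.Properties using (*-monoˡ-≤)
  open import Data.Nat.Solver using (module +-*-Solver)
  open import Data.Product using (_,_)
  open import Data.Rational
    using (0ℚ; 1ℚ; _≤_; _<_; _+_; _*_; 1/_; ∣_∣; toℚᵘ; Positive; NonZero; positive)
  open import Data.Rational.Properties
    using ( toℚᵘ-fromℚᵘ; toℚᵘ-cancel-≤; toℚᵘ-homo-+; toℚᵘ-homo-*
          ; pos⇒nonZero; pos⇒nonNeg; 1/pos⇒pos; pos*pos⇒pos; positive⁻¹; 0≤p⇒∣p∣≡p; <⇒≤
          ; *-monoˡ-≤-nonNeg; *-assoc; *-inverseʳ; *-identityˡ; module ≤-Reasoning)
  import Data.Rational.Unnormalised as ℚᵘ
  import Data.Rational.Unnormalised.Properties as ℚᵘ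
  open import Relation.Binary.PropositionalEquality

  toℚᵘ-ratio : ∀ a n .{{_ : ℕ.NonZero n}} → toℚᵘ (ratio a n) ℚᵘ.≃ (+ a ℚᵘ./ n)
  toℚᵘ-ratio a (suc n) = toℚᵘ-fromℚᵘ (+ a ℚᵘ./ suc n)

  -- The cross-multiplied form of a / KM ≤ b / K + 4 · c / 2KM, with the denominators as ℚᵘ computes them.
  cross-multiplied-bound : ∀ a b c K M → a ℕ.≤ M ℕ.* b ℕ.+ 2 ℕ.* c →
    let D = 1 ℕ.* (2 ℕ.* (K ℕ.* M)) in
    + a ℤ.* + (K ℕ.* D) ℤ.≤ (+ b ℤ.* + D ℤ.+ + 4 ℤ.* + c ℤ.* + K) ℤ.* + (K ℕ.* M)
  cross-multiplied-bound a b c K M a≤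
    rewrite sym (pos-* a (K ℕ.* (1 ℕ.* (2 ℕ.* (K ℕ.* M))))) | sym (pos-* b (1 ℕ.* (2 ℕ.* (K ℕ.* M))))
          | sym (pos-* 4 c) | sym (pos-* (4 ℕ.* c) K)
          | sym (pos-* (b ℕ.* (1 ℕ.* (2 ℕ.* (K ℕ.* M))) ℕ.+ 4 ℕ.* c ℕ.* K) (K ℕ.* M))
    = +≤+ (begin
        a ℕ.* (K ℕ.* D)                              ≤⟨ *-monoˡ-≤ (K ℕ.* D) a≤ ⟩
        (M ℕ.* b ℕ.+ 2 ℕ.* c) ℕ.* (K ℕ.* D)         ≡⟨ solve 4 (λ b c K M →
            (M :* b :+ con 2 :* c) :* (K :* (con 1 :* (con 2 :* (K :* M))))
              := (b :* (con 1 :* (con 2 :* (K :* M))) :+ con 4 :* c :* K) :* (K :* M)) refl b c K M ⟩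
        (b ℕ.* D ℕ.+ 4 ℕ.* c ℕ.* K) ℕ.* (K ℕ.* M)   ∎)
    where
      open Data.Nat.Properties.≤-Reasoning
      open +-*-Solver using (solve; _:=_; _:+_; _:*_; con)
      D : ℕ
      D = 1 ℕ.* (2 ℕ.* (K ℕ.* M))

  ratio-bound : ∀ {a b c k m} → 0 ℕ.< k → 0 ℕ.< m → a ℕ.≤ m ℕ.* b ℕ.+ 2 ℕ.* c →
    ratio a (k ℕ.* m) ≤ ratio b k + ratio 4 1 * ratio c (2 ℕ.* (k ℕ.* m))
  ratio-bound {a} {b} {c} {suc k} {suc m} _ _ a≤ = toℚᵘ-cancel-≤ (begin
    toℚᵘ (ratio a (K ℕ.* M))
      ≃⟨ toℚᵘ-ratio a (K ℕ.* M) ⟩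
    + a ℚᵘ./ (K ℕ.* M)
      ≤⟨ ℚᵘ.*≤* (cross-multiplied-bound a b c K M a≤) ⟩
    + b ℚᵘ./ K ℚᵘ.+ (+ 4 ℚᵘ./ 1) ℚᵘ.* (+ c ℚᵘ./ N)
      ≃⟨ ℚᵘ.+-cong (toℚᵘ-ratio b K) (ℚᵘ.*-cong (toℚᵘ-ratio 4 1) (toℚᵘ-ratio c N)) ⟨
    toℚᵘ (ratio b K) ℚᵘ.+ toℚᵘ (ratio 4 1) ℚᵘ.* toℚᵘ (ratio c N)
      ≃⟨ ℚᵘ.+-cong (ℚᵘ.≃-refl {toℚᵘ (ratio b K)}) (toℚᵘ-homo-* (ratio 4 1) (ratio c N)) ⟨
    toℚᵘ (ratio b K) ℚᵘ.+ toℚᵘ (ratio 4 1 * ratio c N)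
      ≃⟨ toℚᵘ-homo-+ (ratio b K) (ratio 4 1 * ratio c N) ⟨
    toℚᵘ (ratio b K + ratio 4 1 * ratio c N)
      ∎)
    where
      open ℚᵘ.≤-Reasoning
      K M N : ℕ
      K = suc k
      M = suc m
      N = 2 ℕ.* (K ℕ.* M)

  *-tendsToZeroAtZero : ∀ r .{{_ : Positive r}} → TendsToZeroAtZero (r *_)
  *-tendsToZeroAtZero r η 0<η = 1/ r * η , positive⁻¹ (1/ r * η) , bound
    where
      instance
        r≢0 : NonZero r
        r≢0 = pos⇒nonZero r
        1/r>0 : Positive (1/ r)
        1/r>0 = 1/pos⇒pos r
        η>0 : Positive η
        η>0 = positive 0<η
        1/r*η>0 : Positive (1/ r * η)
        1/r*η>0 = pos*pos⇒pos (1/ r) η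

      bound : ∀ ε → 0ℚ < ε → ε ≤ 1/ r * η → ∣ r * ε ∣ ≤ η
      bound ε 0<ε ε≤ = begin
        ∣ r * ε ∣        ≡⟨ 0≤p⇒∣p∣≡p (<⇒≤ (positive⁻¹ (r * ε) {{r*ε>0}})) ⟩
        r * ε            ≤⟨ *-monoˡ-≤-nonNeg r {{pos⇒nonNeg r}} ε≤ ⟩
        r * (1/ r * η)   ≡⟨ *-assoc r (1/ r) η ⟨
        r * 1/ r * η     ≡⟨ cong (_* η) (*-inverseʳ r) ⟩
        1ℚ * η           ≡⟨ *-identityˡ η ⟩
        η                ∎
        where
          open ≤-Reasoning
          r*ε>0 : Positive (r * ε)
          r*ε>0 = pos*pos⇒pos r ε {{positive 0<ε}}

open import Defs
open import Data.Nat using (ℕ; _*_)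
import Data.Nat
open import Data.Fin using (Fin)
open import Data.Rational using (ℚ; _≤_; _+_)
open import Data.Product using (Σ; _×_; _,_)
open import Data.Rational.Properties using (≤-trans; +-monoʳ-≤; *-monoˡ-≤-nonNeg)
open Lifts using (minDom-lift-bound)
open Fractions using (ratio-bound; *-tendsToZeroAtZero)

proposition4p12 :
    (d k : ℕ) → 0 Data.Nat.< k →
    (M : Fin k → Fin k → ℕ) → SymMat M → RegularMat d M →
    Σ (ℚ → ℚ) λ δ →
      TendsToZeroAtZero δ ×
      ((m : ℕ) → 0 Data.Nat.< m →
       (L L' : Graph (k * m)) → IsLift M m L → IsRegular d L' →
       (ε : ℚ) → dist L L' ≤ ε →
       (sH sL' : ℕ) → IsMinDomSize (matAdj M) sH → IsMinDomSize (adj L') sL' →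
       ratio sL' (k * m) ≤ ratio sH k + δ ε)
proposition4p12 d k k>0 M _ _ = (ratio 4 1 Data.Rational.*_) , *-tendsToZeroAtZero (ratio 4 1) ,
  λ m m>0 L L' (σ , lift) _ ε L≈L' sH sL' minH minL' →
    ≤-trans (ratio-bound k>0 m>0 (minDom-lift-bound M L L' σ lift minH minL'))
            (+-monoʳ-≤ (ratio sH k) (*-monoˡ-≤-nonNeg (ratio 4 1) L≈L'))
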